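{- Let $\ell$ be an odd prime, $p$ a prime with $\ell\mid p-1$, $\zeta_\ell\in\mathbb{F}_p$ a primitive $\ell$-th root of unity, and $n\in\mathbb{Z}$. In the ring $\mathbb{F}_p[t][t^{1/\ell},(1-t)^{1/\ell}]$, the ideal $I_n=(t^{1/\ell}-\zeta_\ell^n,(1-t)^{1/\ell})$ is prime, and the principal ideal $(t^{1/\ell}-\zeta_\ell^n)$ equals $I_n^\ell$.
   Context: $t$ is transcendental over $\mathbb{F}_p$, and $t^{1/\ell}$, $(1-t)^{1/\ell}$ are fixed $\ell$-th roots of $t$ and $1-t$; the ring is the subring of $\mathbb{F}_p(t)(t^{1/\ell},(1-t)^{1/\ell})$ generated over $\mathbb{F}_p[t]$ by these two elements. -}

module Defs where

open import Data.Nat as ℕ using (ℕ; zero; suc; _∸_; _<_)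
open import Data.Integer as ℤ using (ℤ; +_; -[1+_])
open import Data.Integer.Divisibility using () renaming (_∣_ to _∣ℤ_)
open import Data.Product using (_×_; Σ; ∃₂)
open import Data.Sum using (_⊎_)
open import Relation.Nullary using (¬_)
open import Relation.Binary.PropositionalEquality using (_≡_)

IsPrimitiveRootMod : ℕ → ℕ → ℤ → Set
IsPrimitiveRootMod p ℓ ζ =
  ((+ p) ∣ℤ ((ζ ℤ.^ ℓ) ℤ.- ℤ.1ℤ))
  × (∀ k → 0 < k → k < ℓ → ¬ ((+ p) ∣ℤ ((ζ ℤ.^ k) ℤ.- ℤ.1ℤ)))

-- ζ^n for n ∈ ℤ, using ζ^{-1} = ζ^{ℓ-1} (valid since ζ^ℓ = 1)
zpow : ℕ → ℤ → ℤ → ℤ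
zpow ℓ ζ (+ k)      = ζ ℤ.^ k
zpow ℓ ζ -[1+ k ]   = (ζ ℤ.^ (ℓ ∸ 1)) ℤ.^ suc k

-- Syntax of ring expressions in the generators t, u = t^{1/ℓ}, v = (1-t)^{1/ℓ}
-- with integer constants (reduced mod p by the relations below).
infixl 6 _⊕_
infixl 7 _⊗_
data Expr : Set where
  con : ℤ → Expr
  T U V : Expr
  _⊕_ _⊗_ : Expr → Expr → Expr
  ⊝_ : Expr → Expr

pow : Expr → ℕ → Expr
pow a zero    = con ℤ.1ℤ
pow a (suc k) = a ⊗ pow a k

-- The ring 𝔽_p[t][t^{1/ℓ},(1-t)^{1/ℓ}] presented by generators and relations:
-- commutative ring axioms, p = 0, u^ℓ = t, v^ℓ = 1 - t.
module Ring (p ℓ : ℕ) where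

  infix 4 _≈_
  data _≈_ : Expr → Expr → Set where
    ≈-refl  : ∀ {a} → a ≈ a
    ≈-sym   : ∀ {a b} → a ≈ b → b ≈ a
    ≈-trans : ∀ {a b c} → a ≈ b → b ≈ c → a ≈ c
    ⊕-cong  : ∀ {a b c d} → a ≈ b → c ≈ d → a ⊕ c ≈ b ⊕ d
    ⊗-cong  : ∀ {a b c d} → a ≈ b → c ≈ d → a ⊗ c ≈ b ⊗ d
    ⊝-cong  : ∀ {a b} → a ≈ b → ⊝ a ≈ ⊝ b
    ⊕-assoc : ∀ a b c → (a ⊕ b) ⊕ c ≈ a ⊕ (b ⊕ c)
    ⊕-comm  : ∀ a b → a ⊕ b ≈ b ⊕ a
    ⊕-idˡ   : ∀ a → con ℤ.0ℤ ⊕ a ≈ a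
    ⊕-invˡ  : ∀ a → (⊝ a) ⊕ a ≈ con ℤ.0ℤ
    ⊗-assoc : ∀ a b c → (a ⊗ b) ⊗ c ≈ a ⊗ (b ⊗ c)
    ⊗-comm  : ∀ a b → a ⊗ b ≈ b ⊗ a
    ⊗-idˡ   : ∀ a → con ℤ.1ℤ ⊗ a ≈ a
    distribˡ : ∀ a b c → a ⊗ (b ⊕ c) ≈ (a ⊗ b) ⊕ (a ⊗ c)
    con-+   : ∀ i j → con (i ℤ.+ j) ≈ con i ⊕ con j
    con-*   : ∀ i j → con (i ℤ.* j) ≈ con i ⊗ con j
    char-p  : con (+ p) ≈ con ℤ.0ℤ
    rel-u   : pow U ℓ ≈ T
    rel-v   : pow V ℓ ≈ con ℤ.1ℤ ⊕ (⊝ T)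

  data ⟨_⟩ (P : Expr → Set) : Expr → Set where
    gen  : ∀ {a} → P a → ⟨ P ⟩ a
    zer  : ⟨ P ⟩ (con ℤ.0ℤ)
    add  : ∀ {a b} → ⟨ P ⟩ a → ⟨ P ⟩ b → ⟨ P ⟩ (a ⊕ b)
    mul  : ∀ r {a} → ⟨ P ⟩ a → ⟨ P ⟩ (r ⊗ a)
    resp : ∀ {a b} → a ≈ b → ⟨ P ⟩ a → ⟨ P ⟩ b

  Ideal : Set₁
  Ideal = Expr → Set

  principal : Expr → Ideal
  principal g = ⟨ (λ a → a ≡ g) ⟩

  ideal₂ : Expr → Expr → Ideal
  ideal₂ g h = ⟨ (λ a → (a ≡ g) ⊎ (a ≡ h)) ⟩

  _·_ : Ideal → Ideal → Ideal
  I · J = ⟨ (λ c → ∃₂ λ a b → I a × J b × (c ≡ a ⊗ b)) ⟩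

  _^ᴵ_ : Ideal → ℕ → Ideal
  I ^ᴵ zero  = ⟨ (λ a → a ≡ con ℤ.1ℤ) ⟩
  I ^ᴵ suc k = (I ^ᴵ k) · I

  IsPrimeIdeal : Ideal → Set
  IsPrimeIdeal I = ¬ I (con ℤ.1ℤ) × (∀ a b → I (a ⊗ b) → I a ⊎ I b)

  SameIdeal : Ideal → Ideal → Set
  SameIdeal I J = ∀ a → (I a → J a) × (J a → I a)

  Iₙ : ℤ → ℤ → Ideal
  Iₙ ζ n = ideal₂ (U ⊕ (⊝ con (zpow ℓ ζ n))) V

{-# OPTIONS --safe #-}
-- Evaluation at t = 1, u = c, v = 0, where c = ζⁿ satisfies c^ℓ = 1 in 𝔽_p, is a ring map onto the
-- field 𝔽_p whose kernel is Iₙ = (π, v) with π = u − c; hence Iₙ is prime.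
-- Expanding u^ℓ = (π + c)^ℓ to first order in π gives v^ℓ = 1 − u^ℓ = −π (D + π g) with D = ℓ c^{ℓ−1},
-- which is a unit because ℓ ∣ p − 1. So every element r π + s v^ℓ of Iₙ^ℓ lies in (π). Conversely
-- π ≡ −D⁻¹ g π² modulo v^ℓ ∈ Iₙ^ℓ, and iterating this pushes π down to a multiple of π^ℓ ∈ Iₙ^ℓ.
module Submission where

open import Defs
open import Data.Nat using (ℕ)
open import Data.Nat.Divisibility using (_∣_)
open import Data.Nat.Primality using (Prime)
open import Data.Integer using (ℤ)
open import Data.Product using (_×_)
open import Relation.Binary.PropositionalEquality using (_≢_)
open import Data.Nat using (_∸_)

open import Data.Nat as ℕ using (zero; suc)
import Data.Nat.Properties as ℕ
import Data.Nat.Divisibility as ℕ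
open import Data.Nat.Primality using (euclidsLemma; ¬prime[0]; ¬prime[1])
open import Data.Integer as ℤ using (+_; -[1+_]; _-_)
import Data.Integer.Properties as ℤ
open import Data.Integer.Divisibility.Signed as Signed using (divides)
open import Data.Integer.Solver using (module +-*-Solver)
open import Data.Empty using (⊥-elim)
open import Data.Maybe using (just; nothing)
open import Data.Product as Σ using (Σ; ∃; _,_)
open import Function using (_∘_)
open import Data.Sum using (_⊎_; inj₁; inj₂; map)

open import Algebra.Bundles using (CommutativeRing)
open import Algebra.Solver.Ring.AlmostCommutativeRing
  using (_-Raw-AlmostCommutative⟶_; Induced-equivalence; fromCommutativeRing)
open import Relation.Binary.Definitions using (WeaklyDecidable)
open import Relation.Binary.PropositionalEquality using (_≡_; refl; sym; trans; cong; subst; module ≡-Reasoning)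
open import Relation.Nullary using (¬_; yes; no)

module Congruence (p : ℕ) where
  open +-*-Solver

  infix 4 _∼_
  record _∼_ (x y : ℤ) : Set where
    constructor mk∼
    field p∣difference : Signed._∣_ (+ p) (x - y)

  private
    p∣_ : ℤ → Set
    p∣ z = Signed._∣_ (+ p) z

    p∣-≡ : ∀ {x y} → x ≡ y → p∣ x → p∣ y
    p∣-≡ = subst p∣_

  ∼-reflexive : ∀ {x y} → x ≡ y → x ∼ y
  ∼-reflexive {x} refl = mk∼ (divides ℤ.0ℤ (ℤ.+-inverseʳ x))

  ∼-sym : ∀ {x y} → x ∼ y → y ∼ x
  ∼-sym {x} {y} (mk∼ h) =
    mk∼ (p∣-≡ (solve 2 (λ x y → :- (x :- y) := y :- x) refl x y) (Signed.∣m⇒∣-m h))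

  ∼-trans : ∀ {x y z} → x ∼ y → y ∼ z → x ∼ z
  ∼-trans {x} {y} {z} (mk∼ h) (mk∼ k) =
    mk∼ (p∣-≡ (solve 3 (λ x y z → (x :- y) :+ (y :- z) := x :- z) refl x y z) (Signed.∣m∣n⇒∣m+n h k))

  +-cong : ∀ {a b c d} → a ∼ b → c ∼ d → a ℤ.+ c ∼ b ℤ.+ d
  +-cong {a} {b} {c} {d} (mk∼ h) (mk∼ k) =
    mk∼ (p∣-≡ (solve 4 (λ a b c d → (a :- b) :+ (c :- d) := (a :+ c) :- (b :+ d)) refl a b c d)
              (Signed.∣m∣n⇒∣m+n h k))

  *-cong : ∀ {a b c d} → a ∼ b → c ∼ d → a ℤ.* c ∼ b ℤ.* d
  *-cong {a} {b} {c} {d} (mk∼ h) (mk∼ k) =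
    mk∼ (p∣-≡ (solve 4 (λ a b c d → (a :- b) :* c :+ b :* (c :- d) := a :* c :- b :* d) refl a b c d)
              (Signed.∣m∣n⇒∣m+n (Signed.∣m⇒∣m*n c h) (Signed.∣n⇒∣m*n b k)))

  -‿cong : ∀ {a b} → a ∼ b → ℤ.- a ∼ ℤ.- b
  -‿cong {a} {b} (mk∼ h) =
    mk∼ (p∣-≡ (solve 2 (λ a b → :- (a :- b) := (:- a) :- (:- b)) refl a b) (Signed.∣m⇒∣-m h))

  p∼0 : + p ∼ ℤ.0ℤ
  p∼0 = mk∼ (p∣-≡ (sym (ℤ.+-identityʳ (+ p))) Signed.∣-refl)

  ^-∼1 : ∀ {x} → x ∼ ℤ.1ℤ → ∀ k → x ℤ.^ k ∼ ℤ.1ℤ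
  ^-∼1 x∼1 zero    = ∼-reflexive refl
  ^-∼1 x∼1 (suc k) = *-cong x∼1 (^-∼1 x∼1 k)

  ∼0⇒∣ : ∀ {x} → x ∼ ℤ.0ℤ → p ∣ ℤ.∣ x ∣
  ∼0⇒∣ {x} (mk∼ h) = Signed.∣⇒∣ᵤ (p∣-≡ (ℤ.+-identityʳ x) h)

  ∣⇒∼0 : ∀ {x} → p ∣ ℤ.∣ x ∣ → x ∼ ℤ.0ℤ
  ∣⇒∼0 {x} h = mk∼ (p∣-≡ (sym (ℤ.+-identityʳ x)) (Signed.∣ᵤ⇒∣ h))

  1≁0 : Prime p → ¬ ℤ.1ℤ ∼ ℤ.0ℤ
  1≁0 p-prime 1∼0 = ¬prime[1] (subst Prime (ℕ.∣1⇒≡1 (∼0⇒∣ 1∼0)) p-prime)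

  *-∼0 : Prime p → ∀ x y → x ℤ.* y ∼ ℤ.0ℤ → x ∼ ℤ.0ℤ ⊎ y ∼ ℤ.0ℤ
  *-∼0 p-prime x y xy∼0
    with euclidsLemma ℤ.∣ x ∣ ℤ.∣ y ∣ p-prime (subst (p ∣_) (ℤ.abs-* x y) (∼0⇒∣ xy∼0))
  ... | inj₁ p∣x = inj₁ (∣⇒∼0 p∣x)
  ... | inj₂ p∣y = inj₂ (∣⇒∼0 p∣y)

  ^-root : ∀ x ℓ → x ℤ.^ ℓ ∼ ℤ.1ℤ → ∀ k → (x ℤ.^ k) ℤ.^ ℓ ∼ ℤ.1ℤ
  ^-root x ℓ xˡ∼1 k = ∼-trans (∼-reflexive (begin
      (x ℤ.^ k) ℤ.^ ℓ   ≡⟨ ℤ.^-*-assoc x k ℓ ⟩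
      x ℤ.^ (k ℕ.* ℓ)   ≡⟨ cong (x ℤ.^_) (ℕ.*-comm k ℓ) ⟩
      x ℤ.^ (ℓ ℕ.* k)   ≡⟨ ℤ.^-*-assoc x ℓ k ⟨
      (x ℤ.^ ℓ) ℤ.^ k   ∎))
    (^-∼1 xˡ∼1 k)
    where open ≡-Reasoning

zpow-≡-^ : ∀ ℓ ζ n → ∃ λ k → zpow ℓ ζ n ≡ ζ ℤ.^ k
zpow-≡-^ ℓ ζ (+ k)    = k , refl
zpow-≡-^ ℓ ζ -[1+ k ] = (ℓ ∸ 1) ℕ.* suc k , ℤ.^-*-assoc ζ (ℓ ∸ 1) (suc k)

zpow-root : ∀ {p ℓ ζ} → Congruence._∼_ p (ζ ℤ.^ ℓ) ℤ.1ℤ →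
            ∀ n → Congruence._∼_ p (zpow ℓ ζ n ℤ.^ ℓ) ℤ.1ℤ
zpow-root {p} {ℓ} {ζ} ζˡ∼1 n with zpow-≡-^ ℓ ζ n
... | k , zpow≡ζᵏ = subst (λ x → x ℤ.^ ℓ ∼ ℤ.1ℤ) (sym zpow≡ζᵏ) (^-root ζ ℓ ζˡ∼1 k)
  where open Congruence p using (_∼_; ^-root)

divisor-of-pred-invertible : ∀ {p′ ℓ m} → p′ ≡ m ℕ.* ℓ →
                             Congruence._∼_ (suc p′) (+ ℓ ℤ.* ℤ.- + m) ℤ.1ℤ
divisor-of-pred-invertible {p′} {ℓ} {m} p′≡mℓ =
  mk∼ (subst (Signed._∣_ (+ suc p′)) (sym ℓ·-m-1≡-p) (Signed.∣m⇒∣-m Signed.∣-refl))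
  where
  open Congruence (suc p′) using (mk∼)
  open +-*-Solver
  open ≡-Reasoning
  ℓ·-m-1≡-p : + ℓ ℤ.* ℤ.- + m - ℤ.1ℤ ≡ ℤ.- + suc p′
  ℓ·-m-1≡-p = begin
    + ℓ ℤ.* ℤ.- + m - ℤ.1ℤ
      ≡⟨ solve 2 (λ L M → L :* (:- M) :- con ℤ.1ℤ := :- (con ℤ.1ℤ :+ M :* L)) refl (+ ℓ) (+ m) ⟩
    ℤ.- (ℤ.1ℤ ℤ.+ + m ℤ.* + ℓ)  ≡⟨ cong (λ z → ℤ.- (ℤ.1ℤ ℤ.+ z)) (sym (ℤ.pos-* m ℓ)) ⟩
    ℤ.- + suc (m ℕ.* ℓ)         ≡⟨ cong (λ z → ℤ.- + suc z) (sym p′≡mℓ) ⟩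
    ℤ.- + suc p′                ∎

linear-coefficient-step : ∀ c k → c ℤ.^ suc k ℤ.+ + suc k ℤ.* c ℤ.^ k ℤ.* c ≡ + suc (suc k) ℤ.* c ℤ.^ suc k
linear-coefficient-step c k = trans
  (solve 3 (λ s c cᵏ → c :* cᵏ :+ s :* cᵏ :* c := (con (+ 1) :+ s) :* (c :* cᵏ)) refl (+ suc k) c (c ℤ.^ k))
  (cong (ℤ._* c ℤ.^ suc k) (sym (ℤ.pos-+ 1 (suc k))))
  where open +-*-Solver

module Presented (p ℓ : ℕ) where
  open Ring p ℓ public
  open Congruence p using (_∼_; mk∼)

  commutativeRing : CommutativeRing _ _
  commutativeRing = record
    { Carrier = Expr ; _≈_ = _≈_ ; _+_ = _⊕_ ; _*_ = _⊗_ ; -_ = ⊝_ ; 0# = con ℤ.0ℤ ; 1# = con ℤ.1ℤ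
    ; isCommutativeRing = record
      { isRing = record
        { +-isAbelianGroup = record
          { isGroup = record
            { isMonoid = record
              { isSemigroup = record
                { isMagma = record
                  { isEquivalence = record { refl = ≈-refl ; sym = ≈-sym ; trans = ≈-trans }
                  ; ∙-cong = ⊕-cong }
                ; assoc = ⊕-assoc }
              ; identity = ⊕-idˡ , λ a → ≈-trans (⊕-comm a _) (⊕-idˡ a) }
            ; inverse = ⊕-invˡ , λ a → ≈-trans (⊕-comm a _) (⊕-invˡ a)
            ; ⁻¹-cong = ⊝-cong }
          ; comm = ⊕-comm }
        ; *-cong = ⊗-cong
        ; *-assoc = ⊗-assoc
        ; *-identity = ⊗-idˡ , λ a → ≈-trans (⊗-comm a _) (⊗-idˡ a)
        ; distrib = distribˡ , λ a b c → ≈-trans (⊗-comm _ a)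
                      (≈-trans (distribˡ a b c) (⊕-cong (⊗-comm a b) (⊗-comm a c))) }
      ; *-comm = ⊗-comm } }

  open CommutativeRing commutativeRing public using (setoid)
  open import Algebra.Properties.Group (CommutativeRing.+-group commutativeRing) using (inverseˡ-unique)
  open import Relation.Binary.Reasoning.Setoid setoid public

  ≡⇒con≈ : ∀ {i j} → i ≡ j → con i ≈ con j
  ≡⇒con≈ refl = ≈-refl

  con-⊝ : ∀ i → con (ℤ.- i) ≈ ⊝ con i
  con-⊝ i = inverseˡ-unique _ _ (≈-trans (≈-sym (con-+ (ℤ.- i) i)) (≡⇒con≈ (ℤ.+-inverseˡ i)))

  con-morphism : ℤ.+-*-rawRing -Raw-AlmostCommutative⟶ fromCommutativeRing commutativeRing
  con-morphism = record
    { ⟦_⟧ = con ; +-homo = con-+ ; *-homo = con-* ; -‿homo = con-⊝ ; 0-homo = ≈-refl ; 1-homo = ≈-refl }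

  con-≟ : WeaklyDecidable (Induced-equivalence con-morphism)
  con-≟ i j with i ℤ.≟ j
  ... | yes refl = just ≈-refl
  ... | no _     = nothing

  open import Algebra.Solver.Ring ℤ.+-*-rawRing (fromCommutativeRing commutativeRing) con-morphism con-≟ public
    using (solve; _:=_; _:+_; _:*_; :-_) renaming (con to :con)

  con-resp-∼ : ∀ {x y} → x ∼ y → con x ≈ con y
  con-resp-∼ {x} {y} (mk∼ (divides q x-y≡qp)) = begin
    con x                          ≈⟨ ≡⇒con≈ x≡y+qp ⟩
    con (y ℤ.+ q ℤ.* + p)          ≈⟨ ≈-trans (con-+ y _) (⊕-cong ≈-refl (con-* q (+ p))) ⟩
    con y ⊕ con q ⊗ con (+ p)      ≈⟨ ⊕-cong ≈-refl (⊗-cong ≈-refl char-p) ⟩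
    con y ⊕ con q ⊗ con ℤ.0ℤ       ≈⟨ solve 2 (λ y q → y :+ q :* :con ℤ.0ℤ := y) ≈-refl (con y) (con q) ⟩
    con y                          ∎
    where
    open +-*-Solver using () renaming (solve to ℤ-solve; _:=_ to _:=ℤ_; _:+_ to _:+ℤ_; _:-_ to _:-ℤ_)
    x≡y+qp : x ≡ y ℤ.+ q ℤ.* + p
    x≡y+qp = trans (ℤ-solve 2 (λ x y → x :=ℤ y :+ℤ (x :-ℤ y)) refl x y) (cong (λ z → y ℤ.+ z) x-y≡qp)

  pow-cong : ∀ {a b} k → a ≈ b → pow a k ≈ pow b k
  pow-cong zero    a≈b = ≈-refl
  pow-cong (suc k) a≈b = ⊗-cong a≈b (pow-cong k a≈b)

  pow-⊕-con : ∀ y c k → Σ Expr λ g →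
    pow (y ⊕ con c) (suc k) ≈ con (c ℤ.^ suc k) ⊕ y ⊗ con (+ suc k ℤ.* c ℤ.^ k) ⊕ (y ⊗ y) ⊗ g
  pow-⊕-con y c zero = con ℤ.0ℤ , (begin
    (y ⊕ C) ⊗ con ℤ.1ℤ
      ≈⟨ solve 2 (λ y C → (y :+ C) :* :con ℤ.1ℤ := C :* :con ℤ.1ℤ :+ y :* :con ℤ.1ℤ :+ (y :* y) :* :con ℤ.0ℤ)
                 ≈-refl y C ⟩
    C ⊗ con ℤ.1ℤ ⊕ y ⊗ con ℤ.1ℤ ⊕ (y ⊗ y) ⊗ con ℤ.0ℤ
      ≈⟨ ⊕-cong (⊕-cong (≈-sym (con-* c ℤ.1ℤ)) ≈-refl) ≈-refl ⟩
    con (c ℤ.^ 1) ⊕ y ⊗ con (+ 1 ℤ.* c ℤ.^ 0) ⊕ (y ⊗ y) ⊗ con ℤ.0ℤ ∎)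
    where C = con c
  pow-⊕-con y c (suc k) with pow-⊕-con y c k
  ... | g , expansion = d ⊕ (y ⊕ C) ⊗ g , (begin
    (y ⊕ C) ⊗ pow (y ⊕ C) (suc k)            ≈⟨ ⊗-cong ≈-refl expansion ⟩
    (y ⊕ C) ⊗ (cᵏ⁺¹ ⊕ y ⊗ d ⊕ (y ⊗ y) ⊗ g)
      ≈⟨ solve 5 (λ y C cᵏ⁺¹ d g → (y :+ C) :* (cᵏ⁺¹ :+ y :* d :+ (y :* y) :* g)
                   := C :* cᵏ⁺¹ :+ y :* (cᵏ⁺¹ :+ d :* C) :+ (y :* y) :* (d :+ (y :+ C) :* g))
                 ≈-refl y C cᵏ⁺¹ d g ⟩
    C ⊗ cᵏ⁺¹ ⊕ y ⊗ (cᵏ⁺¹ ⊕ d ⊗ C) ⊕ (y ⊗ y) ⊗ (d ⊕ (y ⊕ C) ⊗ g)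
      ≈⟨ ⊕-cong (⊕-cong (≈-sym (con-* c _)) (⊗-cong ≈-refl coefficient)) ≈-refl ⟩
    con (c ℤ.^ suc (suc k)) ⊕ y ⊗ con (+ suc (suc k) ℤ.* c ℤ.^ suc k) ⊕ (y ⊗ y) ⊗ (d ⊕ (y ⊕ C) ⊗ g) ∎)
    where
    C cᵏ⁺¹ d : Expr
    C    = con c
    cᵏ⁺¹ = con (c ℤ.^ suc k)
    d    = con (+ suc k ℤ.* c ℤ.^ k)
    coefficient : cᵏ⁺¹ ⊕ d ⊗ C ≈ con (+ suc (suc k) ℤ.* c ℤ.^ suc k)
    coefficient = begin
      cᵏ⁺¹ ⊕ d ⊗ C                                         ≈⟨ ⊕-cong ≈-refl (≈-sym (con-* _ c)) ⟩
      con (c ℤ.^ suc k) ⊕ con (+ suc k ℤ.* c ℤ.^ k ℤ.* c)  ≈⟨ ≈-sym (con-+ _ _) ⟩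
      con (c ℤ.^ suc k ℤ.+ + suc k ℤ.* c ℤ.^ k ℤ.* c)      ≈⟨ ≡⇒con≈ (linear-coefficient-step c k) ⟩
      con (+ suc (suc k) ℤ.* c ℤ.^ suc k)                  ∎

  infix 4 _⊆_
  _⊆_ : Ideal → Ideal → Set
  I ⊆ J = ∀ {a} → I a → J a

  record IsIdeal (J : Ideal) : Set where
    field
      zero∈ : J (con ℤ.0ℤ)
      ⊕-closed : ∀ {a b} → J a → J b → J (a ⊕ b)
      ⊗-closed : ∀ r {a} → J a → J (r ⊗ a)
      ≈-closed : ∀ {a b} → a ≈ b → J a → J b

  ⟨⟩-isIdeal : ∀ P → IsIdeal ⟨ P ⟩
  ⟨⟩-isIdeal P = record { zero∈ = zer ; ⊕-closed = add ; ⊗-closed = mul ; ≈-closed = resp }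

  ⟨⟩-least : ∀ {P J} → IsIdeal J → P ⊆ J → ⟨ P ⟩ ⊆ J
  ⟨⟩-least J-ideal P⊆J (gen a∈P)    = P⊆J a∈P
  ⟨⟩-least J-ideal P⊆J zer          = IsIdeal.zero∈ J-ideal
  ⟨⟩-least J-ideal P⊆J (add a∈ b∈)  =
    IsIdeal.⊕-closed J-ideal (⟨⟩-least J-ideal P⊆J a∈) (⟨⟩-least J-ideal P⊆J b∈)
  ⟨⟩-least J-ideal P⊆J (mul r a∈)   = IsIdeal.⊗-closed J-ideal r (⟨⟩-least J-ideal P⊆J a∈)
  ⟨⟩-least J-ideal P⊆J (resp a≈b a∈) = IsIdeal.≈-closed J-ideal a≈b (⟨⟩-least J-ideal P⊆J a∈)

  principal-least : ∀ {g J} → IsIdeal J → J g → principal g ⊆ J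
  principal-least J-ideal g∈J = ⟨⟩-least J-ideal λ { refl → g∈J }

  pow∈^ᴵ : ∀ {I a} k → I a → (I ^ᴵ k) (pow a k)
  pow∈^ᴵ zero    a∈I = gen refl
  pow∈^ᴵ {a = a} (suc k) a∈I = resp (⊗-comm (pow a k) a) (gen (pow a k , a , pow∈^ᴵ k a∈I , a∈I , refl))

  pow∈⇒∈ : ∀ {J g w α β} → IsIdeal J → J w → g ≈ α ⊗ w ⊕ β ⊗ (g ⊗ g) →
              ∀ k → J (pow g (suc k)) → J g
  pow∈⇒∈ {J} {g} {w} {α} {β} J-ideal w∈J g≈ = descend
    where
    open IsIdeal J-ideal
    descend : ∀ k → J (pow g (suc k)) → J g
    descend zero    g¹∈J = ≈-closed (solve 1 (λ g → g :* :con ℤ.1ℤ := g) ≈-refl g) g¹∈J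
    descend (suc k) gᵏ⁺²∈J =
      descend k (≈-closed (≈-sym step) (⊕-closed (⊗-closed _ w∈J) (⊗-closed β gᵏ⁺²∈J)))
      where
      step : pow g (suc k) ≈ (α ⊗ pow g k) ⊗ w ⊕ β ⊗ pow g (suc (suc k))
      step = begin
        g ⊗ pow g k                      ≈⟨ ⊗-cong g≈ ≈-refl ⟩
        (α ⊗ w ⊕ β ⊗ (g ⊗ g)) ⊗ pow g k
          ≈⟨ solve 5 (λ g α w β gᵏ → (α :* w :+ β :* (g :* g)) :* gᵏ := (α :* gᵏ) :* w :+ β :* (g :* (g :* gᵏ)))
                     ≈-refl g α w β (pow g k) ⟩
        (α ⊗ pow g k) ⊗ w ⊕ β ⊗ pow g (suc (suc k)) ∎

  Span₂ : Expr → Expr → Ideal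
  Span₂ g h a = Σ Expr λ r → Σ Expr λ s → a ≈ r ⊗ g ⊕ s ⊗ h

  Span₂-isIdeal : ∀ g h → IsIdeal (Span₂ g h)
  Span₂-isIdeal g h = record
    { zero∈ = con ℤ.0ℤ , con ℤ.0ℤ , solve 2 (λ g h → :con ℤ.0ℤ := :con ℤ.0ℤ :* g :+ :con ℤ.0ℤ :* h) ≈-refl g h
    ; ⊕-closed = λ { (r , s , a≈) (r′ , s′ , b≈) → r ⊕ r′ , s ⊕ s′ , ≈-trans (⊕-cong a≈ b≈)
        (solve 6 (λ g h r s r′ s′ → (r :* g :+ s :* h) :+ (r′ :* g :+ s′ :* h) := (r :+ r′) :* g :+ (s :+ s′) :* h)
           ≈-refl g h r s r′ s′) }
    ; ⊗-closed = λ { q (r , s , a≈) → q ⊗ r , q ⊗ s , ≈-trans (⊗-cong ≈-refl a≈)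
        (solve 5 (λ g h q r s → q :* (r :* g :+ s :* h) := (q :* r) :* g :+ (q :* s) :* h) ≈-refl g h q r s) }
    ; ≈-closed = λ { a≈b (r , s , a≈) → r , s , ≈-trans (≈-sym a≈b) a≈ }
    }

  ideal₂⊆Span₂ : ∀ g h → ideal₂ g h ⊆ Span₂ g h
  ideal₂⊆Span₂ g h = ⟨⟩-least (Span₂-isIdeal g h) λ
    { (inj₁ refl) → con ℤ.1ℤ , con ℤ.0ℤ , solve 2 (λ g h → g := :con ℤ.1ℤ :* g :+ :con ℤ.0ℤ :* h) ≈-refl g h
    ; (inj₂ refl) → con ℤ.0ℤ , con ℤ.1ℤ , solve 2 (λ g h → h := :con ℤ.0ℤ :* g :+ :con ℤ.1ℤ :* h) ≈-refl g h }

  ideal₂^ᴵ⊆Span₂ : ∀ g h k → ideal₂ g h ^ᴵ k ⊆ Span₂ g (pow h k)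
  ideal₂^ᴵ⊆Span₂ g h zero = ⟨⟩-least (Span₂-isIdeal g _) λ
    { refl → con ℤ.0ℤ , con ℤ.1ℤ , solve 1 (λ g → :con ℤ.1ℤ := :con ℤ.0ℤ :* g :+ :con ℤ.1ℤ :* :con ℤ.1ℤ) ≈-refl g }
  ideal₂^ᴵ⊆Span₂ g h (suc k) = ⟨⟩-least (Span₂-isIdeal g _) λ
    { (b , d , b∈ , d∈ , refl) → product (ideal₂^ᴵ⊆Span₂ g h k b∈) (ideal₂⊆Span₂ g h d∈) }
    where
    product : ∀ {b d} → Span₂ g (pow h k) b → Span₂ g h d → Span₂ g (pow h (suc k)) (b ⊗ d)
    product (r , s , b≈) (r′ , s′ , d≈) = r ⊗ r′ ⊗ g ⊕ r ⊗ s′ ⊗ h ⊕ s ⊗ pow h k ⊗ r′ , s ⊗ s′ ,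
      ≈-trans (⊗-cong b≈ d≈) (solve 7 (λ g h hᵏ r s r′ s′ →
          (r :* g :+ s :* hᵏ) :* (r′ :* g :+ s′ :* h)
        := (r :* r′ :* g :+ r :* s′ :* h :+ s :* hᵏ :* r′) :* g :+ (s :* s′) :* (h :* hᵏ))
        ≈-refl g h (pow h k) r s r′ s′)

  Span₂⊆principal : ∀ {g h q} → h ≈ g ⊗ q → Span₂ g h ⊆ principal g
  Span₂⊆principal {g} {h} {q} h≈gq {a} (r , s , a≈) = resp (≈-sym a≈g) (mul (r ⊕ s ⊗ q) (gen refl))
    where
    a≈g : a ≈ (r ⊕ s ⊗ q) ⊗ g
    a≈g = ≈-trans a≈ (≈-trans (⊕-cong ≈-refl (⊗-cong ≈-refl h≈gq))
            (solve 4 (λ g q r s → r :* g :+ s :* (g :* q) := (r :+ s :* q) :* g) ≈-refl g q r s))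

module Evaluation (p ℓ′ : ℕ) (c : ℤ) (cˡ∼1 : Congruence._∼_ p (c ℤ.^ suc ℓ′) ℤ.1ℤ) where
  open Congruence p
  open Presented p (suc ℓ′) public

  eval : Expr → ℤ
  eval (con i) = i
  eval T       = ℤ.1ℤ
  eval U       = c
  eval V       = ℤ.0ℤ
  eval (a ⊕ b) = eval a ℤ.+ eval b
  eval (a ⊗ b) = eval a ℤ.* eval b
  eval (⊝ a)   = ℤ.- eval a

  eval-pow : ∀ a k → eval (pow a k) ≡ eval a ℤ.^ k
  eval-pow a zero    = refl
  eval-pow a (suc k) = cong (eval a ℤ.*_) (eval-pow a k)

  eval-resp : ∀ {a b} → a ≈ b → eval a ∼ eval b
  eval-resp ≈-refl              = ∼-reflexive refl
  eval-resp (≈-sym a≈b)         = ∼-sym (eval-resp a≈b)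
  eval-resp (≈-trans a≈b b≈c)   = ∼-trans (eval-resp a≈b) (eval-resp b≈c)
  eval-resp (⊕-cong a≈b c≈d)    = +-cong (eval-resp a≈b) (eval-resp c≈d)
  eval-resp (⊗-cong a≈b c≈d)    = *-cong (eval-resp a≈b) (eval-resp c≈d)
  eval-resp (⊝-cong a≈b)        = -‿cong (eval-resp a≈b)
  eval-resp (⊕-assoc a b d)     = ∼-reflexive (ℤ.+-assoc (eval a) (eval b) (eval d))
  eval-resp (⊕-comm a b)        = ∼-reflexive (ℤ.+-comm (eval a) (eval b))
  eval-resp (⊕-idˡ a)           = ∼-reflexive (ℤ.+-identityˡ (eval a))
  eval-resp (⊕-invˡ a)          = ∼-reflexive (ℤ.+-inverseˡ (eval a))
  eval-resp (⊗-assoc a b d)     = ∼-reflexive (ℤ.*-assoc (eval a) (eval b) (eval d))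
  eval-resp (⊗-comm a b)        = ∼-reflexive (ℤ.*-comm (eval a) (eval b))
  eval-resp (⊗-idˡ a)           = ∼-reflexive (ℤ.*-identityˡ (eval a))
  eval-resp (distribˡ a b d)    = ∼-reflexive (ℤ.*-distribˡ-+ (eval a) (eval b) (eval d))
  eval-resp (con-+ i j)         = ∼-reflexive refl
  eval-resp (con-* i j)         = ∼-reflexive refl
  eval-resp char-p              = p∼0
  eval-resp rel-u               = ∼-trans (∼-reflexive (eval-pow U (suc ℓ′))) cˡ∼1
  eval-resp rel-v               = ∼-reflexive refl

  π : Expr
  π = U ⊕ ⊝ con c

  𝔪 : Ideal
  𝔪 = ideal₂ π V

  Ker : Ideal
  Ker a = eval a ∼ ℤ.0ℤ

  Ker-isIdeal : IsIdeal Ker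
  Ker-isIdeal = record
    { zero∈    = ∼-reflexive refl
    ; ⊕-closed = +-cong
    ; ⊗-closed = λ r a∈ → ∼-trans (*-cong (∼-reflexive {eval r} refl) a∈) (∼-reflexive (ℤ.*-zeroʳ (eval r)))
    ; ≈-closed = λ a≈b a∈ → ∼-trans (∼-sym (eval-resp a≈b)) a∈
    }

  𝔪⊆Ker : 𝔪 ⊆ Ker
  𝔪⊆Ker = ⟨⟩-least Ker-isIdeal λ
    { (inj₁ refl) → ∼-reflexive (ℤ.+-inverseʳ c)
    ; (inj₂ refl) → ∼-reflexive refl }

  minus-eval∈𝔪 : ∀ a → 𝔪 (a ⊕ ⊝ con (eval a))
  minus-eval∈𝔪 (con i) = resp (solve 1 (λ x → :con ℤ.0ℤ := x :+ :- x) ≈-refl (con i)) zer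
  minus-eval∈𝔪 T = resp (begin
    (⊝ pow V ℓ′) ⊗ V    ≈⟨ solve 2 (λ v w → (:- w) :* v := :- (v :* w)) ≈-refl V (pow V ℓ′) ⟩
    ⊝ pow V (suc ℓ′)    ≈⟨ ⊝-cong rel-v ⟩
    ⊝ (con ℤ.1ℤ ⊕ ⊝ T)  ≈⟨ solve 1 (λ t → :- (:con ℤ.1ℤ :+ :- t) := t :+ :- :con ℤ.1ℤ) ≈-refl T ⟩
    T ⊕ ⊝ con ℤ.1ℤ      ∎) (mul (⊝ pow V ℓ′) (gen (inj₂ refl)))
  minus-eval∈𝔪 U = gen (inj₁ refl)
  minus-eval∈𝔪 V = resp (solve 1 (λ v → v := v :+ :- :con ℤ.0ℤ) ≈-refl V) (gen (inj₂ refl))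
  minus-eval∈𝔪 (a ⊕ b) = resp (begin
    (a ⊕ ⊝ A) ⊕ (b ⊕ ⊝ B)
      ≈⟨ solve 4 (λ a b A B → (a :+ :- A) :+ (b :+ :- B) := (a :+ b) :+ :- (A :+ B)) ≈-refl a b A B ⟩
    (a ⊕ b) ⊕ ⊝ (A ⊕ B)    ≈⟨ ⊕-cong ≈-refl (⊝-cong (≈-sym (con-+ (eval a) (eval b)))) ⟩
    (a ⊕ b) ⊕ ⊝ con (eval a ℤ.+ eval b) ∎) (add (minus-eval∈𝔪 a) (minus-eval∈𝔪 b))
    where A = con (eval a); B = con (eval b)
  minus-eval∈𝔪 (a ⊗ b) = resp (begin
    b ⊗ (a ⊕ ⊝ A) ⊕ A ⊗ (b ⊕ ⊝ B)
      ≈⟨ solve 4 (λ a b A B → b :* (a :+ :- A) :+ A :* (b :+ :- B) := a :* b :+ :- (A :* B)) ≈-refl a b A B ⟩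
    a ⊗ b ⊕ ⊝ (A ⊗ B)              ≈⟨ ⊕-cong ≈-refl (⊝-cong (≈-sym (con-* (eval a) (eval b)))) ⟩
    a ⊗ b ⊕ ⊝ con (eval a ℤ.* eval b) ∎) (add (mul b (minus-eval∈𝔪 a)) (mul A (minus-eval∈𝔪 b)))
    where A = con (eval a); B = con (eval b)
  minus-eval∈𝔪 (⊝ a) = resp (begin
    (⊝ con ℤ.1ℤ) ⊗ (a ⊕ ⊝ A)
      ≈⟨ solve 2 (λ a A → (:- :con ℤ.1ℤ) :* (a :+ :- A) := :- a :+ :- (:- A)) ≈-refl a A ⟩
    ⊝ a ⊕ ⊝ (⊝ A)             ≈⟨ ⊕-cong ≈-refl (⊝-cong (≈-sym (con-⊝ (eval a)))) ⟩
    ⊝ a ⊕ ⊝ con (ℤ.- eval a)  ∎) (mul (⊝ con ℤ.1ℤ) (minus-eval∈𝔪 a))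
    where A = con (eval a)

  Ker⊆𝔪 : Ker ⊆ 𝔪
  Ker⊆𝔪 {a} a∈Ker = resp (begin
    a ⊕ ⊝ con (eval a)   ≈⟨ ⊕-cong ≈-refl (⊝-cong (con-resp-∼ a∈Ker)) ⟩
    a ⊕ ⊝ con ℤ.0ℤ       ≈⟨ solve 1 (λ a → a :+ :- :con ℤ.0ℤ := a) ≈-refl a ⟩
    a                    ∎) (minus-eval∈𝔪 a)

  𝔪-isPrime : Prime p → IsPrimeIdeal 𝔪
  𝔪-isPrime p-prime = (λ 1∈𝔪 → 1≁0 p-prime (𝔪⊆Ker 1∈𝔪)) , λ a b ab∈𝔪 →
    map Ker⊆𝔪 Ker⊆𝔪 (*-∼0 p-prime (eval a) (eval b) (𝔪⊆Ker ab∈𝔪))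

module Ramification (p ℓ′ : ℕ) (c : ℤ) (cˡ∼1 : Congruence._∼_ p (c ℤ.^ suc ℓ′) ℤ.1ℤ)
                    (ℓ⁻¹ : ℤ) (ℓℓ⁻¹∼1 : Congruence._∼_ p (+ suc ℓ′ ℤ.* ℓ⁻¹) ℤ.1ℤ) where
  open Congruence p using (*-cong; ∼-trans; ∼-reflexive)
  open Evaluation p ℓ′ c cˡ∼1 public

  ℓ : ℕ
  ℓ = suc ℓ′

  D D⁻¹ : Expr
  D   = con (+ ℓ ℤ.* c ℤ.^ ℓ′)
  D⁻¹ = con (ℓ⁻¹ ℤ.* c)

  D⊗D⁻¹≈1 : D ⊗ D⁻¹ ≈ con ℤ.1ℤ
  D⊗D⁻¹≈1 = ≈-trans (≈-sym (con-* _ _))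
              (con-resp-∼ (∼-trans (∼-reflexive rearrange) (*-cong ℓℓ⁻¹∼1 cˡ∼1)))
    where
    open +-*-Solver using () renaming (solve to ℤ-solve; _:=_ to _:=ℤ_; _:*_ to _:*ℤ_)
    rearrange : (+ ℓ ℤ.* c ℤ.^ ℓ′) ℤ.* (ℓ⁻¹ ℤ.* c) ≡ (+ ℓ ℤ.* ℓ⁻¹) ℤ.* (c ℤ.* c ℤ.^ ℓ′)
    rearrange = ℤ-solve 4 (λ L cᵏ i c → (L :*ℤ cᵏ) :*ℤ (i :*ℤ c) :=ℤ (L :*ℤ i) :*ℤ (c :*ℤ cᵏ))
                          refl (+ ℓ) (c ℤ.^ ℓ′) ℓ⁻¹ c

  g : Expr
  g = Σ.proj₁ (pow-⊕-con π c ℓ′)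

  vˡ≈π⊗unit : pow V ℓ ≈ π ⊗ ⊝ (D ⊕ π ⊗ g)
  vˡ≈π⊗unit = begin
    pow V ℓ                         ≈⟨ rel-v ⟩
    con ℤ.1ℤ ⊕ ⊝ T                  ≈⟨ ⊕-cong ≈-refl (⊝-cong (≈-sym rel-u)) ⟩
    con ℤ.1ℤ ⊕ ⊝ pow U ℓ            ≈⟨ ⊕-cong ≈-refl (⊝-cong (pow-cong ℓ U≈π⊕c)) ⟩
    con ℤ.1ℤ ⊕ ⊝ pow (π ⊕ con c) ℓ  ≈⟨ ⊕-cong ≈-refl (⊝-cong (Σ.proj₂ (pow-⊕-con π c ℓ′))) ⟩
    con ℤ.1ℤ ⊕ ⊝ (con (c ℤ.^ ℓ) ⊕ π ⊗ D ⊕ (π ⊗ π) ⊗ g)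
      ≈⟨ ⊕-cong ≈-refl (⊝-cong (⊕-cong (⊕-cong (con-resp-∼ cˡ∼1) ≈-refl) ≈-refl)) ⟩
    con ℤ.1ℤ ⊕ ⊝ (con ℤ.1ℤ ⊕ π ⊗ D ⊕ (π ⊗ π) ⊗ g)
      ≈⟨ solve 3 (λ π D g → :con ℤ.1ℤ :+ :- (:con ℤ.1ℤ :+ π :* D :+ (π :* π) :* g) := π :* :- (D :+ π :* g))
                 ≈-refl π D g ⟩
    π ⊗ ⊝ (D ⊕ π ⊗ g)               ∎
    where
    U≈π⊕c : U ≈ π ⊕ con c
    U≈π⊕c = solve 2 (λ u c → u := (u :+ :- c) :+ c) ≈-refl U (con c)

  π≈α⊗vˡ⊕β⊗π² : π ≈ (⊝ D⁻¹) ⊗ pow V ℓ ⊕ (⊝ (D⁻¹ ⊗ g)) ⊗ (π ⊗ π)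
  π≈α⊗vˡ⊕β⊗π² = begin
    π              ≈⟨ solve 1 (λ π → π := π :* :con ℤ.1ℤ) ≈-refl π ⟩
    π ⊗ con ℤ.1ℤ   ≈⟨ ⊗-cong ≈-refl (≈-sym D⊗D⁻¹≈1) ⟩
    π ⊗ (D ⊗ D⁻¹)
      ≈⟨ solve 4 (λ π D D⁻¹ g → π :* (D :* D⁻¹)
                   := (:- D⁻¹) :* (π :* :- (D :+ π :* g)) :+ (:- (D⁻¹ :* g)) :* (π :* π)) ≈-refl π D D⁻¹ g ⟩
    (⊝ D⁻¹) ⊗ (π ⊗ ⊝ (D ⊕ π ⊗ g)) ⊕ (⊝ (D⁻¹ ⊗ g)) ⊗ (π ⊗ π)
      ≈⟨ ⊕-cong (⊗-cong ≈-refl (≈-sym vˡ≈π⊗unit)) ≈-refl ⟩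
    (⊝ D⁻¹) ⊗ pow V ℓ ⊕ (⊝ (D⁻¹ ⊗ g)) ⊗ (π ⊗ π) ∎

  π∈𝔪^ℓ : (𝔪 ^ᴵ ℓ) π
  π∈𝔪^ℓ = pow∈⇒∈ (⟨⟩-isIdeal _) (pow∈^ᴵ ℓ (gen (inj₂ refl))) π≈α⊗vˡ⊕β⊗π² ℓ′
                  (pow∈^ᴵ ℓ (gen (inj₁ refl)))

  principal-π≐𝔪^ℓ : SameIdeal (principal π) (𝔪 ^ᴵ ℓ)
  principal-π≐𝔪^ℓ a = principal-least (⟨⟩-isIdeal _) π∈𝔪^ℓ
                     , Span₂⊆principal vˡ≈π⊗unit ∘ ideal₂^ᴵ⊆Span₂ π V ℓ

lemma4p5 : (ℓ p : ℕ) → Prime ℓ → ℓ ≢ 2 → Prime p → ℓ ∣ (p ∸ 1)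
    → (ζ : ℤ) → IsPrimitiveRootMod p ℓ ζ → (n : ℤ)
    → Ring.IsPrimeIdeal p ℓ (Ring.Iₙ p ℓ ζ n)
      × Ring.SameIdeal p ℓ (Ring.principal p ℓ (U ⊕ (⊝ con (zpow ℓ ζ n)))) (Ring._^ᴵ_ p ℓ (Ring.Iₙ p ℓ ζ n) ℓ)
lemma4p5 zero     _        ℓ-prime _ _       _                  _ _             _ = ⊥-elim (¬prime[0] ℓ-prime)
lemma4p5 (suc ℓ′) zero     _       _ p-prime _                  _ _             _ = ⊥-elim (¬prime[0] p-prime)
lemma4p5 (suc ℓ′) (suc p′) _       _ p-prime (ℕ.divides m p′≡mℓ) ζ (p∣ζˡ-1 , _) n =
  𝔪-isPrime p-prime , principal-π≐𝔪^ℓ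
  where
  open Ramification (suc p′) ℓ′ (zpow (suc ℓ′) ζ n) (zpow-root (Congruence.mk∼ (Signed.∣ᵤ⇒∣ p∣ζˡ-1)) n)
                    (ℤ.- + m) (divisor-of-pred-invertible p′≡mℓ)
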